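{- Let $M$ and $N$ be MV-algebras and let $s\colon M\to N$ be a function. The following are equivalent. (1) $s$ is a state. (2) For all $a,b\in M$ the following hold: (A1) $s(a\oplus b)=s(a)\oplus s(b\wedge\neg a)$; (A2) $s(\neg a)=\neg s(a)$; (A3) $s(1)=1$.
   Context: In an MV-algebra, $1:=\neg 0$, $a\odot b:=\neg(\neg a\oplus\neg b)$, and $a\wedge b:=a\odot(\neg a\oplus b)$. For an MV-algebra $N$, let $\Xi N$ be the unital Abelian $\ell$-group associated with $N$ by Mundici's equivalence. We identify $N$ with the unit interval $\{x\in\Xi N\mid 0\le x\le 1\}$, on which $a\oplus b=(a+b)\wedge 1$ and $\neg a=1-a$. A state $s\colon M\to N$ is a function satisfying $s(1)=1$ and $s(a\oplus b)=s(a)+s(b)$ for all $a,b\in M$ with $a\odot b=0$, where $+$ is computed in $\Xi N$. -}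

module Defs where

open import Level using (Level; _⊔_; suc)
open import Data.Nat using (ℕ; zero) renaming (suc to 1+)
open import Data.Product using (Σ; _×_)
open import Relation.Binary.Core using (Rel)
open import Algebra.Structures using (IsCommutativeMonoid; IsAbelianGroup)
open import Algebra.Lattice.Structures using (IsLattice)

record MVAlgebra (c ℓ : Level) : Set (suc (c ⊔ ℓ)) where
  infixl 6 _⊕_
  infix 4 _≈_
  field
    Carrier : Set c
    _≈_     : Rel Carrier ℓ
    _⊕_     : Carrier → Carrier → Carrier
    ¬_      : Carrier → Carrier
    0#      : Carrier
    ⊕-isCommutativeMonoid : IsCommutativeMonoid _≈_ _⊕_ 0#
    ¬-cong  : ∀ {x y} → x ≈ y → ¬ x ≈ ¬ y
    ¬¬      : ∀ x → ¬ (¬ x) ≈ x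
    ⊕-absorb : ∀ x → x ⊕ ¬ 0# ≈ ¬ 0#
    luk     : ∀ x y → ¬ (¬ x ⊕ y) ⊕ y ≈ ¬ (¬ y ⊕ x) ⊕ x

  open IsCommutativeMonoid ⊕-isCommutativeMonoid public

  1# : Carrier
  1# = ¬ 0#

  _⊙_ : Carrier → Carrier → Carrier
  a ⊙ b = ¬ (¬ a ⊕ ¬ b)

  _∧_ : Carrier → Carrier → Carrier
  a ∧ b = a ⊙ (¬ a ⊕ b)

times : ∀ {a} {A : Set a} → (A → A → A) → A → ℕ → A → A
times _+_ e zero x = e
times _+_ e (1+ n) x = x + times _+_ e n x

record UnitalLGroup (c ℓ : Level) : Set (suc (c ⊔ ℓ)) where
  infixl 6 _+_ _-_
  infix 4 _≈_ _≤_
  field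
    Carrier : Set c
    _≈_     : Rel Carrier ℓ
    _+_     : Carrier → Carrier → Carrier
    0#      : Carrier
    -_      : Carrier → Carrier
    _∧_     : Carrier → Carrier → Carrier
    _∨_     : Carrier → Carrier → Carrier
    isAbelianGroup : IsAbelianGroup _≈_ _+_ 0# -_
    isLattice      : IsLattice _≈_ _∨_ _∧_
    +-distrib-∧    : ∀ a b c → a + (b ∧ c) ≈ (a + b) ∧ (a + c)

  _≤_ : Carrier → Carrier → Set ℓ
  a ≤ b = a ∧ b ≈ a

  _-_ : Carrier → Carrier → Carrier
  a - b = a + (- b)

  _·_ : ℕ → Carrier → Carrier
  n · x = times _+_ 0# n x

  field
    u           : Carrier
    0≤u         : 0# ≤ u
    strong-unit : ∀ x → Σ ℕ (λ n → x ≤ n · u)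

  -- The MV-algebra Γ(G,u) = [0,u] of Mundici's equivalence.  Its operations
  -- are given here on all of G; they are only ever applied to elements of
  -- the unit interval (membership is required separately).
  InUnit : Carrier → Set ℓ
  InUnit x = (0# ≤ x) × (x ≤ u)

  _⊕ᴺ_ : Carrier → Carrier → Carrier
  a ⊕ᴺ b = (a + b) ∧ u

  ¬ᴺ_ : Carrier → Carrier
  ¬ᴺ a = u - a

module _ {c₁ ℓ₁ c₂ ℓ₂ : Level} (M : MVAlgebra c₁ ℓ₁) (G : UnitalLGroup c₂ ℓ₂) where
  private
    module M = MVAlgebra M
    module G = UnitalLGroup G

  IsState : (M.Carrier → G.Carrier) → Set (c₁ ⊔ ℓ₁ ⊔ ℓ₂)
  IsState s = (s M.1# G.≈ G.u)
            × (∀ a b → a M.⊙ b M.≈ M.0# → s (a M.⊕ b) G.≈ (s a G.+ s b))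

  A-conditions : (M.Carrier → G.Carrier) → Set (c₁ ⊔ ℓ₂)
  A-conditions s = (∀ a b → s (a M.⊕ b) G.≈ (s a G.⊕ᴺ s (b M.∧ (M.¬ a))))
                 × (∀ a → s (M.¬ a) G.≈ (G.¬ᴺ s a))
                 × (s M.1# G.≈ G.u)

{-# OPTIONS --safe #-}
-- Additivity of s on orthogonal pairs (a ⊙ b = 0) gives (A1), because a ⊕ b is the
-- orthogonal sum of a and b ∧ ¬a, and (A2), because 1 is the orthogonal sum
-- of a and ¬a.  Conversely, a ⊙ b = 0 means b ≤ ¬a, so b ∧ ¬a = b and
-- ¬a = b ⊕ ¬(a ⊕ b); applying (A1) to the latter gives s b ≤ s(¬a) = u − s a,
-- so s a + s b ≤ u and the truncation in (A1) for a ⊕ b is inactive.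
module Submission where

open import Defs
open import Level using (Level)
open import Data.Product using (_×_; _,_; proj₁; proj₂)
open import Algebra.Bundles using (AbelianGroup)
import Algebra.Properties.AbelianGroup as AbelianGroupProperties
open import Algebra.Structures using (IsAbelianGroup)
open import Algebra.Lattice.Structures using (IsLattice)
import Relation.Binary.Reasoning.Setoid as SetoidReasoning

module MVAlgebraProperties {c ℓ : Level} (M : MVAlgebra c ℓ) where
  open MVAlgebra M
  open SetoidReasoning setoid

  ¬1≈0 : ¬ 1# ≈ 0#
  ¬1≈0 = ¬¬ 0#

  ⊕-zeroˡ : ∀ x → 1# ⊕ x ≈ 1#
  ⊕-zeroˡ x = trans (comm 1# x) (⊕-absorb x)

  ¬x⊕x≈1 : ∀ x → ¬ x ⊕ x ≈ 1#
  ¬x⊕x≈1 x = begin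
    ¬ x ⊕ x              ≈⟨ ∙-congʳ (¬-cong (identityˡ x)) ⟨
    ¬ (0# ⊕ x) ⊕ x       ≈⟨ ∙-congʳ (¬-cong (∙-congʳ ¬1≈0)) ⟨
    ¬ (¬ 1# ⊕ x) ⊕ x     ≈⟨ luk x 1# ⟨
    ¬ (¬ x ⊕ 1#) ⊕ 1#    ≈⟨ ⊕-absorb _ ⟩
    1#                   ∎

  x⊕¬x≈1 : ∀ x → x ⊕ ¬ x ≈ 1#
  x⊕¬x≈1 x = trans (comm x (¬ x)) (¬x⊕x≈1 x)

  x⊙¬x≈0 : ∀ x → x ⊙ (¬ x) ≈ 0#
  x⊙¬x≈0 x = begin
    ¬ (¬ x ⊕ ¬ (¬ x))    ≈⟨ ¬-cong (∙-congˡ (¬¬ x)) ⟩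
    ¬ (¬ x ⊕ x)          ≈⟨ ¬-cong (¬x⊕x≈1 x) ⟩
    ¬ 1#                 ≈⟨ ¬1≈0 ⟩
    0#                   ∎

  x⊙y≈0⇒¬y⊕¬x≈1 : ∀ {x y} → x ⊙ y ≈ 0# → ¬ y ⊕ ¬ x ≈ 1#
  x⊙y≈0⇒¬y⊕¬x≈1 {x} {y} x⊙y≈0 = begin
    ¬ y ⊕ ¬ x            ≈⟨ comm (¬ y) (¬ x) ⟩
    ¬ x ⊕ ¬ y            ≈⟨ ¬¬ _ ⟨
    ¬ (x ⊙ y)            ≈⟨ ¬-cong x⊙y≈0 ⟩
    ¬ 0#                 ∎

  ¬[y∧¬x]≈x⊕¬[x⊕y] : ∀ x y → ¬ (y ∧ (¬ x)) ≈ x ⊕ ¬ (x ⊕ y)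
  ¬[y∧¬x]≈x⊕¬[x⊕y] x y = begin
    ¬ (y ∧ (¬ x))             ≈⟨ ¬¬ _ ⟩
    ¬ y ⊕ ¬ (¬ y ⊕ ¬ x)     ≈⟨ comm _ _ ⟩
    ¬ (¬ y ⊕ ¬ x) ⊕ ¬ y     ≈⟨ ∙-congʳ (¬-cong (comm (¬ y) (¬ x))) ⟩
    ¬ (¬ x ⊕ ¬ y) ⊕ ¬ y     ≈⟨ luk x (¬ y) ⟩
    ¬ (¬ (¬ y) ⊕ x) ⊕ x     ≈⟨ ∙-congʳ (¬-cong (trans (∙-congʳ (¬¬ y)) (comm y x))) ⟩
    ¬ (x ⊕ y) ⊕ x           ≈⟨ comm _ _ ⟩
    x ⊕ ¬ (x ⊕ y)           ∎

  x⊕[y∧¬x]≈x⊕y : ∀ x y → x ⊕ (y ∧ (¬ x)) ≈ x ⊕ y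
  x⊕[y∧¬x]≈x⊕y x y = begin
    x ⊕ (y ∧ (¬ x))                ≈⟨ ∙-congˡ (¬¬ _) ⟨
    x ⊕ ¬ (¬ (y ∧ (¬ x)))          ≈⟨ ∙-congˡ (¬-cong (¬[y∧¬x]≈x⊕¬[x⊕y] x y)) ⟩
    x ⊕ ¬ (x ⊕ ¬ (x ⊕ y))        ≈⟨ comm _ _ ⟩
    ¬ (x ⊕ ¬ (x ⊕ y)) ⊕ x        ≈⟨ ∙-congʳ (¬-cong (comm x _)) ⟩
    ¬ (¬ (x ⊕ y) ⊕ x) ⊕ x        ≈⟨ luk (x ⊕ y) x ⟩
    ¬ (¬ x ⊕ (x ⊕ y)) ⊕ (x ⊕ y)  ≈⟨ ∙-congʳ (¬-cong (assoc (¬ x) x y)) ⟨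
    ¬ ((¬ x ⊕ x) ⊕ y) ⊕ (x ⊕ y)  ≈⟨ ∙-congʳ (¬-cong (trans (∙-congʳ (¬x⊕x≈1 x)) (⊕-zeroˡ y))) ⟩
    ¬ 1# ⊕ (x ⊕ y)               ≈⟨ trans (∙-congʳ ¬1≈0) (identityˡ _) ⟩
    x ⊕ y                        ∎

  x⊙[y∧¬x]≈0 : ∀ x y → x ⊙ (y ∧ (¬ x)) ≈ 0#
  x⊙[y∧¬x]≈0 x y = begin
    ¬ (¬ x ⊕ ¬ (y ∧ (¬ x)))        ≈⟨ ¬-cong (∙-congˡ (¬[y∧¬x]≈x⊕¬[x⊕y] x y)) ⟩
    ¬ (¬ x ⊕ (x ⊕ ¬ (x ⊕ y)))    ≈⟨ ¬-cong (assoc (¬ x) x _) ⟨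
    ¬ ((¬ x ⊕ x) ⊕ ¬ (x ⊕ y))    ≈⟨ ¬-cong (trans (∙-congʳ (¬x⊕x≈1 x)) (⊕-zeroˡ _)) ⟩
    ¬ 1#                         ≈⟨ ¬1≈0 ⟩
    0#                           ∎

  x⊙y≈0⇒y∧¬x≈y : ∀ {x y} → x ⊙ y ≈ 0# → y ∧ (¬ x) ≈ y
  x⊙y≈0⇒y∧¬x≈y {x} {y} x⊙y≈0 = begin
    ¬ (¬ y ⊕ ¬ (¬ y ⊕ ¬ x))      ≈⟨ ¬-cong (∙-congˡ (¬-cong (x⊙y≈0⇒¬y⊕¬x≈1 x⊙y≈0))) ⟩
    ¬ (¬ y ⊕ ¬ 1#)               ≈⟨ ¬-cong (trans (∙-congˡ ¬1≈0) (identityʳ _)) ⟩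
    ¬ (¬ y)                      ≈⟨ ¬¬ y ⟩
    y                            ∎

  x⊙y≈0⇒¬x≈y⊕¬[x⊕y] : ∀ {x y} → x ⊙ y ≈ 0# → ¬ x ≈ y ⊕ ¬ (x ⊕ y)
  x⊙y≈0⇒¬x≈y⊕¬[x⊕y] {x} {y} x⊙y≈0 = begin
    ¬ x                          ≈⟨ trans (∙-congʳ ¬1≈0) (identityˡ _) ⟨
    ¬ 1# ⊕ ¬ x                   ≈⟨ ∙-congʳ (¬-cong (x⊙y≈0⇒¬y⊕¬x≈1 x⊙y≈0)) ⟨
    ¬ (¬ y ⊕ ¬ x) ⊕ ¬ x          ≈⟨ luk (¬ x) y ⟨
    ¬ (¬ (¬ x) ⊕ y) ⊕ y          ≈⟨ ∙-congʳ (¬-cong (∙-congʳ (¬¬ x))) ⟩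
    ¬ (x ⊕ y) ⊕ y                ≈⟨ comm _ _ ⟩
    y ⊕ ¬ (x ⊕ y)                ∎

module UnitalLGroupProperties {c ℓ : Level} (G : UnitalLGroup c ℓ) where
  open UnitalLGroup G
  open IsAbelianGroup isAbelianGroup using (setoid; sym; trans; ∙-congˡ; identityʳ; comm)
  open IsLattice isLattice using (∧-congˡ; ∧-congʳ; ∧-assoc)
  open SetoidReasoning setoid

  abelianGroup : AbelianGroup c ℓ
  abelianGroup = record { isAbelianGroup = isAbelianGroup }

  open AbelianGroupProperties abelianGroup using (x≈z//y; //-rightDividesˡ)

  x+y≈z⇒y≈z-x : ∀ {x y z} → x + y ≈ z → y ≈ z - x
  x+y≈z⇒y≈z-x {x} {y} {z} x+y≈z = x≈z//y y x z (trans (comm y x) x+y≈z)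

  x+[z-x]≈z : ∀ x z → x + (z - x) ≈ z
  x+[z-x]≈z x z = trans (comm x (z - x)) (//-rightDividesˡ x z)

  ≤-respʳ-≈ : ∀ {x y z} → x ≤ y → y ≈ z → x ≤ z
  ≤-respʳ-≈ x≤y y≈z = trans (∧-congˡ (sym y≈z)) x≤y

  ∧-greatest : ∀ {x y z} → x ≤ y → x ≤ z → x ≤ y ∧ z
  ∧-greatest {x} {y} {z} x≤y x≤z = begin
    x ∧ (y ∧ z)          ≈⟨ ∧-assoc x y z ⟨
    (x ∧ y) ∧ z          ≈⟨ ∧-congʳ x≤y ⟩
    x ∧ z                ≈⟨ x≤z ⟩
    x                    ∎

  +-monoʳ-≤ : ∀ x {y z} → y ≤ z → x + y ≤ x + z
  +-monoʳ-≤ x {y} {z} y≤z = begin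
    (x + y) ∧ (x + z)    ≈⟨ +-distrib-∧ x y z ⟨
    x + (y ∧ z)          ≈⟨ ∙-congˡ y≤z ⟩
    x + y                ∎

  0≤y⇒x≤x+y : ∀ {x y} → 0# ≤ y → x ≤ x + y
  0≤y⇒x≤x+y {x} {y} 0≤y = begin
    x ∧ (x + y)          ≈⟨ ∧-congʳ (identityʳ x) ⟨
    (x + 0#) ∧ (x + y)   ≈⟨ +-monoʳ-≤ x 0≤y ⟩
    x + 0#               ≈⟨ identityʳ x ⟩
    x                    ∎

module _ {c₁ ℓ₁ c₂ ℓ₂ : Level} (M : MVAlgebra c₁ ℓ₁) (G : UnitalLGroup c₂ ℓ₂)
         (s : MVAlgebra.Carrier M → UnitalLGroup.Carrier G)
         (s-inUnit : ∀ a → UnitalLGroup.InUnit G (s a))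
         (s-cong : ∀ {a b} → MVAlgebra._≈_ M a b → UnitalLGroup._≈_ G (s a) (s b))
         where
  private
    module M = MVAlgebra M
    module G where
      open UnitalLGroup G public
      open IsAbelianGroup isAbelianGroup public using (setoid; sym; trans; ∙-congˡ)
      open IsLattice isLattice public using (∧-congʳ)
    open MVAlgebraProperties M
    open UnitalLGroupProperties G
    open SetoidReasoning G.setoid

    s-nonneg : ∀ a → G.0# G.≤ s a
    s-nonneg a = proj₁ (s-inUnit a)

    s-≤u : ∀ a → s a G.≤ G.u
    s-≤u a = proj₂ (s-inUnit a)

  IsState⇒A-conditions : IsState M G s → A-conditions M G s
  IsState⇒A-conditions (s1≈u , s-additive) = A1 , A2 , s1≈u
    where
    A1 : ∀ a b → s (a M.⊕ b) G.≈ (s a G.⊕ᴺ s (b M.∧ (M.¬ a)))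
    A1 a b = begin
      s (a M.⊕ b)                          ≈⟨ s-≤u (a M.⊕ b) ⟨
      s (a M.⊕ b) G.∧ G.u                  ≈⟨ G.∧-congʳ s[a⊕b]≈sa+s[b∧¬a] ⟩
      (s a G.+ s (b M.∧ (M.¬ a))) G.∧ G.u  ∎
      where
      s[a⊕b]≈sa+s[b∧¬a] : s (a M.⊕ b) G.≈ s a G.+ s (b M.∧ (M.¬ a))
      s[a⊕b]≈sa+s[b∧¬a] = G.trans (s-cong (M.sym (x⊕[y∧¬x]≈x⊕y a b)))
                                   (s-additive a (b M.∧ (M.¬ a)) (x⊙[y∧¬x]≈0 a b))

    A2 : ∀ a → s (M.¬ a) G.≈ (G.¬ᴺ s a)
    A2 a = x+y≈z⇒y≈z-x (begin
      s a G.+ s (M.¬ a)               ≈⟨ s-additive a (M.¬ a) (x⊙¬x≈0 a) ⟨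
      s (a M.⊕ M.¬ a)                 ≈⟨ s-cong (x⊕¬x≈1 a) ⟩
      s M.1#                          ≈⟨ s1≈u ⟩
      G.u                             ∎)

  A-conditions⇒IsState : A-conditions M G s → IsState M G s
  A-conditions⇒IsState (A1 , A2 , s1≈u) = s1≈u , s-additive
    where
    s-additive : ∀ a b → a M.⊙ b M.≈ M.0# → s (a M.⊕ b) G.≈ s a G.+ s b
    s-additive a b a⊙b≈0 = begin
      s (a M.⊕ b)                          ≈⟨ A1 a b ⟩
      (s a G.+ s (b M.∧ (M.¬ a))) G.∧ G.u  ≈⟨ G.∧-congʳ (G.∙-congˡ (s-cong (x⊙y≈0⇒y∧¬x≈y a⊙b≈0))) ⟩
      (s a G.+ s b) G.∧ G.u                ≈⟨ sa+sb≤u ⟩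
      s a G.+ s b                          ∎
      where
      sb≤s¬a : s b G.≤ s (M.¬ a)
      sb≤s¬a = ≤-respʳ-≈
        (∧-greatest (0≤y⇒x≤x+y (s-nonneg _)) (s-≤u b))
        (G.sym (G.trans (s-cong (x⊙y≈0⇒¬x≈y⊕¬[x⊕y] a⊙b≈0)) (A1 b _)))

      sa+sb≤u : s a G.+ s b G.≤ G.u
      sa+sb≤u = ≤-respʳ-≈ (+-monoʳ-≤ (s a) (≤-respʳ-≈ sb≤s¬a (A2 a))) (x+[z-x]≈z (s a) G.u)

proposition3p3 : {c₁ ℓ₁ c₂ ℓ₂ : Level} (M : MVAlgebra c₁ ℓ₁) (G : UnitalLGroup c₂ ℓ₂)
    (s : MVAlgebra.Carrier M → UnitalLGroup.Carrier G)
    → (∀ a → UnitalLGroup.InUnit G (s a))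
    → (∀ {a b} → MVAlgebra._≈_ M a b → UnitalLGroup._≈_ G (s a) (s b))
    → (IsState M G s → A-conditions M G s) × (A-conditions M G s → IsState M G s)
proposition3p3 M G s s-inUnit s-cong =
  IsState⇒A-conditions M G s s-inUnit s-cong , A-conditions⇒IsState M G s s-inUnit s-cong
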